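{- Let $p\ge1$, $s\ge1$ and let $(\mathbf{d},\mathbf{r})$ be a smooth arithmetical structure on the coconut tree $\mathcal{CT}(p,s)$. Then $\gcd(r_{\ell_1},\dots,r_{\ell_s})=1$.
   Context: The coconut tree $\mathcal{CT}(p,s)$ is the graph with vertices $v_1,\dots,v_p,v_{\ell_1},\dots,v_{\ell_s}$ and edges $v_iv_{i+1}$ for $1\le i\le p-1$ and $v_pv_{\ell_j}$ for $1\le j\le s$. An arithmetical structure on a finite connected simple graph is a pair $(\mathbf{d},\mathbf{r})$ of vectors of positive integers indexed by the vertices such that for every vertex $v$, $d_v r_v$ equals the sum of $r_u$ over the neighbors $u$ of $v$ (i.e. $(\operatorname{diag}(\mathbf{d})-A)\mathbf{r}=0$ with $A$ the adjacency matrix), and the entries of $\mathbf{r}$ have gcd $1$. On $\mathcal{CT}(p,s)$ we write $\mathbf{r}=(r_1,\dots,r_p,r_{\ell_1},\dots,r_{\ell_s})$, $\mathbf{d}=(d_1,\dots,d_p,d_{\ell_1},\dots,d_{\ell_s})$. The structure is smooth if $d_1,\dots,d_{p-1},d_{\ell_1},\dots,d_{\ell_s}\ge2$. -}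

module Defs where

open import Data.Nat using (ℕ; zero; suc; _+_; _*_; _≤_; _≥_; _≟_)
open import Data.Nat.GCD using (gcd)
open import Data.Fin using (Fin; toℕ)
open import Data.Sum using (_⊎_; inj₁; inj₂)
open import Data.List using (List; map; foldr; _++_)
open import Data.Nat.ListAction using (sum)
open import Data.Bool using (Bool; true; false; _∧_; _∨_; if_then_else_)
open import Data.List using () renaming (map to lmap)
open import Relation.Nullary.Decidable using (⌊_⌋)
open import Relation.Binary.PropositionalEquality using (_≡_)

-- Vertices of the coconut tree CT(p,s):
--   inj₁ i  (i : Fin p)  is the path vertex v_{i+1}
--   inj₂ j  (j : Fin s)  is the leaf v_{ℓ_{j+1}}
CTVertex : ℕ → ℕ → Set
CTVertex p s = Fin p ⊎ Fin s

ctVertices : (p s : ℕ) → List (CTVertex p s)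
ctVertices p s = lmap inj₁ (Data.List.tabulate {n = p} (λ i → i))
              ++ lmap inj₂ (Data.List.tabulate {n = s} (λ j → j))
  where import Data.List

_==_ : ℕ → ℕ → Bool
m == n = ⌊ m ≟ n ⌋

ctAdj : (p s : ℕ) → CTVertex p s → CTVertex p s → Bool
ctAdj p s (inj₁ i) (inj₁ j) = (suc (toℕ i) == toℕ j) ∨ (suc (toℕ j) == toℕ i)
ctAdj p s (inj₁ i) (inj₂ _) = suc (toℕ i) == p
ctAdj p s (inj₂ _) (inj₁ j) = suc (toℕ j) == p
ctAdj p s (inj₂ _) (inj₂ _) = false

neighbourSum : (p s : ℕ) → (CTVertex p s → ℕ) → CTVertex p s → ℕ
neighbourSum p s r v =
  sum (lmap (λ u → if ctAdj p s v u then r u else 0) (ctVertices p s))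

-- gcd of a list of naturals (gcd [] = 0)
gcdList : List ℕ → ℕ
gcdList = foldr gcd 0

record IsArithmeticalCT (p s : ℕ) (d r : CTVertex p s → ℕ) : Set where
  field
    d-pos   : ∀ v → 1 ≤ d v
    r-pos   : ∀ v → 1 ≤ r v
    balance : ∀ v → d v * r v ≡ neighbourSum p s r v
    r-gcd   : gcdList (lmap r (ctVertices p s)) ≡ 1

IsSmoothCT : (p s : ℕ) → (CTVertex p s → ℕ) → Set
IsSmoothCT p s d =
  (∀ (i : Fin p) → suc (toℕ i) Data.Nat.< p → 2 ≤ d (inj₁ i))
  Data.Product.× (∀ (j : Fin s) → 2 ≤ d (inj₂ j))
  where import Data.Nat
        import Data.Product

leafValues : (p s : ℕ) → (CTVertex p s → ℕ) → List ℕ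
leafValues p s r = lmap (λ j → r (inj₂ j)) (Data.List.tabulate {n = s} (λ j → j))
  where import Data.List

-- Every balance equation expresses d_v r_v as a sum of neighbouring r-values, so a common
-- divisor g of the leaf values spreads along the tree: at a leaf, d_ℓ r_ℓ = r_p gives g ∣ r_p,
-- and at v_{i+1} the equation d_{i+1} r_{i+1} = r_i + r_{i+2} (+ the leaves when i + 1 = p)
-- gives g ∣ r_i, downwards along the path. Thus g divides every r_v, hence divides gcd r = 1.
module Submission where

open import Defs
open import Data.Nat using (ℕ; _≤_)
open import Relation.Binary.PropositionalEquality using (_≡_)

open import Data.Bool using (T; true; false; if_then_else_)
open import Data.Bool.Properties using (T-∨)
open import Data.Empty using (⊥-elim)
open import Data.Fin using (Fin; zero; suc; toℕ; fromℕ; inject₁; _<_; _>_)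
open import Data.Fin.Induction using (>-wellFounded)
open import Data.Fin.Properties
  using (toℕ-injective; toℕ-fromℕ; toℕ-inject₁; suc-injective; ≤-refl; ≤̄⇒inject₁<)
open import Data.Fin.Relation.Unary.Top using (view; ‵fromℕ; ‵inject₁)
open import Data.List using (_∷_; _++_; map; tabulate)
open import Data.List.Properties using (map-++; map-tabulate)
open import Data.List.Membership.Propositional using (_∈_)
open import Data.List.Membership.Propositional.Properties using (∈-map⁺; ∈-tabulate⁺)
open import Data.List.Relation.Unary.All using (All; []; _∷_; universal)
open import Data.List.Relation.Unary.All.Properties using (tabulate⁺) renaming (map⁺ to All-map⁺)
open import Data.List.Relation.Unary.Any using (here; there)
open import Data.Nat using (suc; _+_)
open import Data.Nat.Divisibility using (_∣_; _∣0; ∣-trans; ∣m∣n⇒∣m+n; ∣m+n∣m⇒∣n; ∣n⇒∣m*n; ∣1⇒≡1)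
open import Data.Nat.GCD using (gcd[m,n]∣m; gcd[m,n]∣n; gcd-greatest)
open import Data.Nat.ListAction using (sum)
open import Data.Nat.ListAction.Properties using (sum-++)
open import Data.Nat.Properties using (+-comm)
import Data.Nat.Properties as ℕₚ
open import Data.Sum using (_⊎_; inj₁; inj₂)
open import Data.Sum.Properties using (inj₁-injective)
open import Function using (_∘_; id; Equivalence)
open import Induction.WellFounded using (WfRec; module All)
open import Relation.Binary.PropositionalEquality
  using (refl; sym; trans; cong; cong₂; subst; subst₂; _≢_; module ≡-Reasoning)
open import Relation.Nullary.Decidable using (toWitness; fromWitness)

private variable
  g n : ℕ

gcdList-∣ : ∀ {x xs} → x ∈ xs → gcdList xs ∣ x
gcdList-∣ {xs = x ∷ _} (here refl)  = gcd[m,n]∣m x _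
gcdList-∣ {xs = y ∷ _} (there x∈xs) = ∣-trans (gcd[m,n]∣n y _) (gcdList-∣ x∈xs)

∣-gcdList : ∀ {xs} → All (g ∣_) xs → g ∣ gcdList xs
∣-gcdList []             = _ ∣0
∣-gcdList (g∣x ∷ g∣xs) = gcd-greatest g∣x (∣-gcdList g∣xs)

∣-sum : ∀ {xs} → All (g ∣_) xs → g ∣ sum xs
∣-sum []             = _ ∣0
∣-sum (g∣x ∷ g∣xs) = ∣m∣n⇒∣m+n g∣x (∣-sum g∣xs)

∣m+n∣n⇒∣m : ∀ {m n} → g ∣ m + n → g ∣ n → g ∣ m
∣m+n∣n⇒∣m {g} {m} {n} g∣m+n = ∣m+n∣m⇒∣n (subst (g ∣_) (+-comm m n) g∣m+n)

∣-sum-tabulate⇒∣ : (f : Fin n → ℕ) (k : Fin n) →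
                   (∀ i → i ≢ k → g ∣ f i) → g ∣ sum (tabulate f) → g ∣ f k
∣-sum-tabulate⇒∣ f zero    others g∣Σ =
  ∣m+n∣n⇒∣m g∣Σ (∣-sum (tabulate⁺ λ i → others (suc i) λ ()))
∣-sum-tabulate⇒∣ f (suc k) others g∣Σ =
  ∣-sum-tabulate⇒∣ (f ∘ suc) k (λ i i≢k → others (suc i) (i≢k ∘ suc-injective))
    (∣m+n∣m⇒∣n g∣Σ (others zero λ ()))

∣-if-then-0 : ∀ {x} b → (T b → g ∣ x) → g ∣ (if b then x else 0)
∣-if-then-0 true  g∣x = g∣x _
∣-if-then-0 false _   = _ ∣0

∣-if-then-0⁻ : ∀ {x} b → T b → g ∣ (if b then x else 0) → g ∣ x
∣-if-then-0⁻ true _ g∣x = g∣x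

neighbourTerm : (p s : ℕ) → (CTVertex p s → ℕ) → CTVertex p s → CTVertex p s → ℕ
neighbourTerm p s r v u = if ctAdj p s v u then r u else 0

neighbourSum-split : ∀ p s r (v : CTVertex p s) →
  neighbourSum p s r v ≡ sum (tabulate (neighbourTerm p s r v ∘ inj₁))
                       + sum (tabulate (neighbourTerm p s r v ∘ inj₂))
neighbourSum-split p s r v = begin
  sum (map t (map inj₁ (tabulate id) ++ map inj₂ (tabulate id)))
    ≡⟨ cong sum (map-++ t (map inj₁ (tabulate id)) _) ⟩
  sum (map t (map inj₁ (tabulate id)) ++ map t (map inj₂ (tabulate id)))
    ≡⟨ sum-++ (map t (map inj₁ (tabulate id))) _ ⟩
  sum (map t (map inj₁ (tabulate id))) + sum (map t (map inj₂ (tabulate id)))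
    ≡⟨ cong₂ _+_ (sum-map-tabulate inj₁) (sum-map-tabulate inj₂) ⟩
  sum (tabulate (t ∘ inj₁)) + sum (tabulate (t ∘ inj₂)) ∎
  where
  open ≡-Reasoning
  t : CTVertex p s → ℕ
  t = neighbourTerm p s r v
  sum-map-tabulate : ∀ {n} (f : Fin n → CTVertex p s) →
                     sum (map t (map f (tabulate id))) ≡ sum (tabulate (t ∘ f))
  sum-map-tabulate f = cong sum (trans (cong (map t) (map-tabulate id f)) (map-tabulate f t))

path-adjacent⁺ : ∀ {p s} {i j : Fin p} → suc (toℕ j) ≡ toℕ i → T (ctAdj p s (inj₁ i) (inj₁ j))
path-adjacent⁺ {i = i} {j} j+1≡i =
  Equivalence.from (T-∨ {suc (toℕ i) == toℕ j}) (inj₂ (fromWitness j+1≡i))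

path-adjacent⁻ : ∀ {p s} {i j : Fin p} → T (ctAdj p s (inj₁ i) (inj₁ j)) →
                 suc (toℕ i) ≡ toℕ j ⊎ suc (toℕ j) ≡ toℕ i
path-adjacent⁻ {i = i} {j} adj =
  Data.Sum.map toWitness toWitness (Equivalence.to (T-∨ {suc (toℕ i) == toℕ j}) adj)

module _ {q s : ℕ} {d r : CTVertex (suc q) s → ℕ} (ar : IsArithmeticalCT (suc q) s d r) where
  open IsArithmeticalCT ar

  private
    p : ℕ
    p = suc q

  ∣-r-neighbour : ∀ v k → T (ctAdj p s v (inj₁ k)) → g ∣ r v →
                  (∀ w → w ≢ inj₁ k → T (ctAdj p s v w) → g ∣ r w) → g ∣ r (inj₁ k)
  ∣-r-neighbour {g} v k adj g∣rv others =
    ∣-if-then-0⁻ _ adj (∣-sum-tabulate⇒∣ (t ∘ inj₁) k otherPathTerms g∣pathSum)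
    where
    t : CTVertex p s → ℕ
    t = neighbourTerm p s r v
    g∣neighbourSum : g ∣ sum (tabulate (t ∘ inj₁)) + sum (tabulate (t ∘ inj₂))
    g∣neighbourSum =
      subst (g ∣_) (trans (balance v) (neighbourSum-split p s r v)) (∣n⇒∣m*n (d v) g∣rv)
    g∣pathSum : g ∣ sum (tabulate (t ∘ inj₁))
    g∣pathSum = ∣m+n∣n⇒∣m g∣neighbourSum
      (∣-sum (tabulate⁺ λ j → ∣-if-then-0 _ (others (inj₂ j) λ ())))
    otherPathTerms : ∀ i → i ≢ k → g ∣ t (inj₁ i)
    otherPathTerms i i≢k = ∣-if-then-0 _ (others (inj₁ i) (i≢k ∘ inj₁-injective))

  ∣-r-leaf⇒∣-r-last : ∀ j → g ∣ r (inj₂ j) → g ∣ r (inj₁ (fromℕ q))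
  ∣-r-leaf⇒∣-r-last j g∣rℓ =
    ∣-r-neighbour (inj₂ j) (fromℕ q) (fromWitness (cong suc (toℕ-fromℕ q))) g∣rℓ others
    where
    others : ∀ w → w ≢ inj₁ (fromℕ q) → T (ctAdj p s (inj₂ j) w) → g ∣ r w
    others (inj₁ i) i≢last adj = ⊥-elim (i≢last (cong inj₁ (toℕ-injective
      (trans (ℕₚ.suc-injective (toWitness adj)) (sym (toℕ-fromℕ q))))))

  ∣-r-beyond⇒∣-r-inject₁ : (∀ j → g ∣ r (inj₂ j)) → ∀ i →
                           (∀ {j} → inject₁ i < j → g ∣ r (inj₁ j)) → g ∣ r (inj₁ (inject₁ i))
  ∣-r-beyond⇒∣-r-inject₁ {g} g∣leaves i g∣later =
    ∣-r-neighbour (inj₁ (suc i)) (inject₁ i) adj (g∣later (≤̄⇒inject₁< ≤-refl)) others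
    where
    adj : T (ctAdj p s (inj₁ (suc i)) (inj₁ (inject₁ i)))
    adj = path-adjacent⁺ {s = s} (cong suc (toℕ-inject₁ i))
    others : ∀ w → w ≢ inj₁ (inject₁ i) → T (ctAdj p s (inj₁ (suc i)) w) → g ∣ r w
    others (inj₂ j) _ _ = g∣leaves j
    others (inj₁ j) j≢i adj with path-adjacent⁻ {s = s} adj
    ... | inj₁ i+2≡j   = g∣later (subst₂ Data.Nat._<_ (sym (toℕ-inject₁ i)) i+2≡j (ℕₚ.n≤1+n _))
    ... | inj₂ j+1≡i+1 = ⊥-elim (j≢i (cong inj₁ (toℕ-injective
      (trans (ℕₚ.suc-injective j+1≡i+1) (sym (toℕ-inject₁ i))))))

  ∣-leaves⇒∣-r : Fin s → (∀ j → g ∣ r (inj₂ j)) → ∀ v → g ∣ r v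
  ∣-leaves⇒∣-r {g} ℓ g∣leaves (inj₁ i) = All.wfRec >-wellFounded _ (λ i → g ∣ r (inj₁ i)) step i
    where
    step : ∀ i → WfRec _>_ (λ i → g ∣ r (inj₁ i)) i → g ∣ r (inj₁ i)
    step i g∣later with view i
    ... | ‵fromℕ      = ∣-r-leaf⇒∣-r-last ℓ (g∣leaves ℓ)
    ... | ‵inject₁ i′ = ∣-r-beyond⇒∣-r-inject₁ g∣leaves i′ g∣later
  ∣-leaves⇒∣-r ℓ g∣leaves (inj₂ j) = g∣leaves j

lemma2p6 : (p s : ℕ) → 1 ≤ p → 1 ≤ s → (d r : CTVertex p s → ℕ) → IsArithmeticalCT p s d r → IsSmoothCT p s d → gcdList (leafValues p s r) ≡ 1
lemma2p6 (suc q) (suc t) _ _ d r ar _ =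
  ∣1⇒≡1 (subst (leafGcd ∣_) (IsArithmeticalCT.r-gcd ar) leafGcd∣gcd-r)
  where
  leafGcd : ℕ
  leafGcd = gcdList (leafValues (suc q) (suc t) r)
  leafGcd∣leaves : ∀ j → leafGcd ∣ r (inj₂ j)
  leafGcd∣leaves j = gcdList-∣ (∈-map⁺ (r ∘ inj₂) (∈-tabulate⁺ {f = id} j))
  leafGcd∣gcd-r : leafGcd ∣ gcdList (map r (ctVertices (suc q) (suc t)))
  leafGcd∣gcd-r = ∣-gcdList (All-map⁺
    (universal (∣-leaves⇒∣-r ar zero leafGcd∣leaves) (ctVertices (suc q) (suc t))))
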